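{- For a complete graph $\mathbb{K}_n,$ $S(\mathbb{K}_n)$ is compliant and $d_{td}(a)=\left\lceil\frac{3n}{2}\right\rceil-1,$ for every vertex in $S(\mathbb{K}_n).$
   Context: $S(\mathbb{G})$ denotes the subdivision of $\mathbb{G}$, obtained by replacing each edge by a path of length two. A total dominating set (TDS) is a vertex set $S$ such that every vertex is adjacent to a vertex of $S$; a minimal TDS (MTDS) has no proper subset that is a TDS. A vertex is compliant if some MTDS contains it; a graph is compliant if all its vertices are. For a vertex $a$ of a compliant graph, $d_{td}(a)=\min\{|S| : S \text{ an MTDS containing } a\}$. -}

module Defs where

open import Level using (0ℓ)
open import Data.Nat using (ℕ; _<_; ⌈_/2⌉; _∸_; _*_; _≤_)
open import Data.Fin using (Fin) renaming (_<_ to _<ᶠ_)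
open import Data.Product using (Σ; _×_; _,_; proj₁; proj₂; ∃)
open import Data.Sum using (_⊎_; inj₁; inj₂)
open import Data.List using (List; length)
open import Data.List.Membership.Propositional using (_∈_; _∉_)
open import Data.List.Relation.Unary.Unique.Propositional using (Unique)
open import Relation.Binary.PropositionalEquality using (_≡_)

record Graph : Set₁ where
  field
    V   : Set
    Adj : V → V → Set
open Graph public

Subdivision : (V E : Set) → (E → V × V) → Graph
Subdivision V E ends = record { V = V ⊎ E ; Adj = adj }
  where
  incident : V → E → Set
  incident v e = (v ≡ proj₁ (ends e)) ⊎ (v ≡ proj₂ (ends e))
  adj : V ⊎ E → V ⊎ E → Set
  adj (inj₁ v) (inj₁ w) = Data.Empty.⊥
    where import Data.Empty
  adj (inj₁ v) (inj₂ e) = incident v e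
  adj (inj₂ e) (inj₁ v) = incident v e
  adj (inj₂ e) (inj₂ f) = Data.Empty.⊥
    where import Data.Empty

-- Edges of the complete graph K_n: pairs (i , j) of vertices with i < j
-- (each unordered pair of distinct vertices exactly once).
KEdge : ℕ → Set
KEdge n = Σ (Fin n × Fin n) (λ p → proj₁ p <ᶠ proj₂ p)

SK : ℕ → Graph
SK n = Subdivision (Fin n) (KEdge n) proj₁

module _ (G : Graph) where
  -- Finite vertex sets are represented as duplicate-free lists;
  -- the cardinality |S| is the length of the list.
  FinSet : Set
  FinSet = List (V G)

  _⊆ₛ_ : List (V G) → List (V G) → Set
  T ⊆ₛ S = ∀ {x} → x ∈ T → x ∈ S

  _⊂ₛ_ : List (V G) → List (V G) → Set
  T ⊂ₛ S = T ⊆ₛ S × ∃ λ x → x ∈ S × x ∉ T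

  IsTDS : List (V G) → Set
  IsTDS S = ∀ v → ∃ λ u → u ∈ S × Adj G u v

  IsMTDS : List (V G) → Set
  IsMTDS S = Unique S × IsTDS S
           × (∀ T → Unique T → T ⊂ₛ S → IsTDS T → Data.Empty.⊥)
    where import Data.Empty

  Compliant : V G → Set
  Compliant a = ∃ λ S → IsMTDS S × a ∈ S

  CompliantGraph : Set
  CompliantGraph = ∀ a → Compliant a

  DtdIs : V G → ℕ → Set
  DtdIs a k = (∃ λ S → IsMTDS S × a ∈ S × length S ≡ k)
            × (∀ S → IsMTDS S → a ∈ S → k ≤ length S)

{-# OPTIONS --safe #-}
-- A total dominating set S of S(Kₙ) splits into original vertices and subdivision
-- vertices.  A subdivision vertex is adjacent only to the two ends of its edge, so the
-- original vertices of S form a vertex cover of Kₙ and number at least n - 1; an original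
-- vertex is adjacent only to subdivision vertices, so those of S form an edge cover of Kₙ
-- and number at least ⌈n/2⌉.  Conversely, all vertices but one together with an edge
-- cover of size ⌈n/2⌉ through a prescribed edge form a total dominating set of exactly
-- this size, and the choices can be made so that it contains any prescribed vertex.
-- Being of minimum size, it is minimal, since every proper subset is smaller; hence
-- every vertex lies in a minimal one of size (n - 1) + ⌈n/2⌉ = ⌈3n/2⌉ - 1, and none is smaller.

module Submission where

open import Defs
open import Data.Nat using (ℕ; zero; suc; _+_; _*_; _∸_; _≤_; _<_; s≤s; z≤n; ⌊_/2⌋; ⌈_/2⌉)
open import Data.Nat.Properties
  using (≤-reflexive; ≤-trans; ≤-antisym; n≤1+n; <⇒≱; +-suc; +-mono-≤; ⌈n/2⌉-mono; n≡⌈n+n/2⌉)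
open import Data.Nat.Tactic.RingSolver using (solve-∀)
open import Data.Fin using (Fin; zero; suc; punchIn; punchOut)
import Data.Fin.Properties as Fin
open import Data.Product using (Σ; ∃; _×_; _,_; proj₁; proj₂)
import Data.Product.Properties as Product
open import Data.Sum using (_⊎_; inj₁; inj₂; swap)
import Data.Sum.Properties as Sum
open import Data.Empty using (⊥)
open import Data.List using (List; []; _∷_; length; map; _++_; lookup; deduplicate; allFin)
open import Data.List.Properties using (length-map; length-++; length-tabulate; length-deduplicate)
open import Data.List.Membership.Propositional using (_∈_; _∉_)
open import Data.List.Membership.Propositional.Properties
  using (∈-map⁺; ∈-++⁺ˡ; ∈-++⁺ʳ; ∈-lookup; ∈-allFin; ∈-deduplicate⁺)
open import Data.List.Membership.Setoid.Properties using (index-injective)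
import Data.List.Membership.DecPropositional as DecMembership
open import Data.List.Relation.Binary.Subset.Propositional using (_⊆_)
open import Data.List.Relation.Unary.Any using (here; there)
import Data.List.Relation.Unary.All as All
open import Data.List.Relation.Unary.AllPairs using (_∷_)
open import Data.List.Relation.Unary.Unique.Propositional using (Unique)
open import Data.List.Relation.Unary.Unique.DecPropositional.Properties using (deduplicate-!)
open import Function using (id; _∘_; Injective)
open import Relation.Nullary using (yes; no; contradiction)
open import Relation.Binary.Definitions using (DecidableEquality; tri<; tri≈; tri>)
open import Relation.Binary.PropositionalEquality

module _ {A : Set} where

  injection⇒≤length : ∀ {m} {xs : List A} (f : Fin m → A) → Injective _≡_ _≡_ f →
                      (∀ i → f i ∈ xs) → m ≤ length xs
  injection⇒≤length f f-injective f∈xs =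
    Fin.injective⇒≤ (f-injective ∘ index-injective (setoid A) (f∈xs _) (f∈xs _))

  lookup-injective : ∀ {xs : List A} → Unique xs → ∀ i j → lookup xs i ≡ lookup xs j → i ≡ j
  lookup-injective {_ ∷ _} _            zero    zero    _  = refl
  lookup-injective {_ ∷ _} (x≢xs ∷ _)   zero    (suc j) eq = contradiction eq (All.lookup x≢xs (∈-lookup j))
  lookup-injective {_ ∷ _} (x≢xs ∷ _)   (suc i) zero    eq = contradiction (sym eq) (All.lookup x≢xs (∈-lookup i))
  lookup-injective {_ ∷ _} (_ ∷ unique) (suc i) (suc j) eq = cong suc (lookup-injective unique i j eq)

  unique⊆⇒length≤ : ∀ {xs ys : List A} → Unique xs → xs ⊆ ys → length xs ≤ length ys
  unique⊆⇒length≤ unique xs⊆ys =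
    injection⇒≤length _ (lookup-injective unique _ _) (xs⊆ys ∘ ∈-lookup)

  unique⊂⇒length< : ∀ {xs ys : List A} {y} → Unique xs → xs ⊆ ys → y ∈ ys → y ∉ xs →
                    length xs < length ys
  unique⊂⇒length< {xs} unique xs⊆ys y∈ys y∉xs =
    unique⊆⇒length≤ (All.tabulate y≢ ∷ unique) λ { (here refl) → y∈ys ; (there x∈xs) → xs⊆ys x∈xs }
    where
    y≢ : ∀ {x} → x ∈ xs → _ ≢ x
    y≢ x∈xs refl = y∉xs x∈xs

⌊m+m+n/2⌋≡m+⌊n/2⌋ : ∀ m n → ⌊ (m + m) + n /2⌋ ≡ m + ⌊ n /2⌋
⌊m+m+n/2⌋≡m+⌊n/2⌋ zero    n = refl
⌊m+m+n/2⌋≡m+⌊n/2⌋ (suc m) n rewrite +-suc m m = cong suc (⌊m+m+n/2⌋≡m+⌊n/2⌋ m n)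

⌈3n/2⌉≡n+⌈n/2⌉ : ∀ n → ⌈ 3 * n /2⌉ ≡ n + ⌈ n /2⌉
⌈3n/2⌉≡n+⌈n/2⌉ n = begin
  ⌊ suc (3 * n) /2⌋       ≡⟨ cong ⌊_/2⌋ (regroup n) ⟩
  ⌊ (n + n) + suc n /2⌋   ≡⟨ ⌊m+m+n/2⌋≡m+⌊n/2⌋ n (suc n) ⟩
  n + ⌈ n /2⌉             ∎
  where
  open ≡-Reasoning
  regroup : ∀ n → suc (3 * n) ≡ (n + n) + suc n
  regroup = solve-∀

m≤n+n⇒⌈m/2⌉≤n : ∀ {m n} → m ≤ n + n → ⌈ m /2⌉ ≤ n
m≤n+n⇒⌈m/2⌉≤n {n = n} m≤n+n = ≤-trans (⌈n/2⌉-mono m≤n+n) (≤-reflexive (sym (n≡⌈n+n/2⌉ n)))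

module _ (G : Graph) where

  DtdIs⇒Compliant : ∀ {a k} → DtdIs G a k → Compliant G a
  DtdIs⇒Compliant ((S , mtds , a∈S , _) , _) = S , mtds , a∈S

  minimum⇒MTDS : ∀ {b S} → (∀ T → IsTDS G T → b ≤ length T) →
                 Unique S → IsTDS G S → length S ≤ b → IsMTDS G S
  minimum⇒MTDS {S = S} lower uniqueS tdsS |S|≤b = uniqueS , tdsS , smaller-not-TDS
    where
    smaller-not-TDS : ∀ T → Unique T → _⊂ₛ_ G T S → IsTDS G T → ⊥
    smaller-not-TDS T uniqueT (T⊆S , x , x∈S , x∉T) tdsT =
      <⇒≱ (unique⊂⇒length< uniqueT T⊆S x∈S x∉T) (≤-trans |S|≤b (lower T tdsT))

  module _ (_≟_ : DecidableEquality (V G)) where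

    deduplicate-TDS : ∀ {S} → IsTDS G S → IsTDS G (deduplicate _≟_ S)
    deduplicate-TDS tds v with u , u∈S , u~v ← tds v = u , ∈-deduplicate⁺ _≟_ u∈S , u~v

    minimum⇒DtdIs : ∀ {b a} → (∀ T → IsTDS G T → b ≤ length T) →
                    (∃ λ S → IsTDS G S × a ∈ S × length S ≤ b) → DtdIs G a b
    minimum⇒DtdIs {b} lower (S , tds , a∈S , |S|≤b) =
      (S′ , minimum⇒MTDS lower (deduplicate-! _≟_ S) tds′ |S′|≤b , ∈-deduplicate⁺ _≟_ a∈S ,
        ≤-antisym |S′|≤b (lower S′ tds′)) ,
      λ T (_ , tdsT , _) _ → lower T tdsT
      where
      S′ = deduplicate _≟_ S
      tds′ : IsTDS G S′
      tds′ = deduplicate-TDS tds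
      |S′|≤b : length S′ ≤ b
      |S′|≤b = ≤-trans (length-deduplicate _≟_ S) |S|≤b

module _ {A B : Set} where

  lefts : List (A ⊎ B) → List A
  lefts []            = []
  lefts (inj₁ a ∷ xs) = a ∷ lefts xs
  lefts (inj₂ _ ∷ xs) = lefts xs

  rights : List (A ⊎ B) → List B
  rights []            = []
  rights (inj₁ _ ∷ xs) = rights xs
  rights (inj₂ b ∷ xs) = b ∷ rights xs

  length-lefts+rights : ∀ xs → length (lefts xs) + length (rights xs) ≡ length xs
  length-lefts+rights []            = refl
  length-lefts+rights (inj₁ _ ∷ xs) = cong suc (length-lefts+rights xs)
  length-lefts+rights (inj₂ _ ∷ xs) = trans (+-suc _ _) (cong suc (length-lefts+rights xs))

  ∈-lefts⁺ : ∀ {a xs} → inj₁ a ∈ xs → a ∈ lefts xs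
  ∈-lefts⁺ {xs = inj₁ _ ∷ _} (here refl) = here refl
  ∈-lefts⁺ {xs = inj₁ _ ∷ _} (there p)   = there (∈-lefts⁺ p)
  ∈-lefts⁺ {xs = inj₂ _ ∷ _} (there p)   = ∈-lefts⁺ p

  ∈-rights⁺ : ∀ {b xs} → inj₂ b ∈ xs → b ∈ rights xs
  ∈-rights⁺ {xs = inj₁ _ ∷ _} (there p)   = ∈-rights⁺ p
  ∈-rights⁺ {xs = inj₂ _ ∷ _} (here refl) = here refl
  ∈-rights⁺ {xs = inj₂ _ ∷ _} (there p)   = there (∈-rights⁺ p)

module Subdivided {V E : Set} (ends : E → V × V) where

  private
    G : Graph
    G = Subdivision V E ends

  Incident : V → E → Set
  Incident v e = Adj G (inj₁ v) (inj₂ e)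

  IsVertexCover : List V → Set
  IsVertexCover C = ∀ e → proj₁ (ends e) ∈ C ⊎ proj₂ (ends e) ∈ C

  IsEdgeCover : List E → Set
  IsEdgeCover F = ∀ v → ∃ λ e → e ∈ F × Incident v e

  TDS⇒vertexCover : ∀ {S} → IsTDS G S → IsVertexCover (lefts S)
  TDS⇒vertexCover tds e with tds (inj₂ e)
  ... | inj₁ _ , v∈S , inj₁ refl = inj₁ (∈-lefts⁺ v∈S)
  ... | inj₁ _ , v∈S , inj₂ refl = inj₂ (∈-lefts⁺ v∈S)
  ... | inj₂ _ , _   , ()

  TDS⇒edgeCover : ∀ {S} → IsTDS G S → IsEdgeCover (rights S)
  TDS⇒edgeCover tds v with tds (inj₁ v)
  ... | inj₁ _ , _   , ()
  ... | inj₂ e , e∈S , v~e = e , ∈-rights⁺ e∈S , v~e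

  covers⇒TDS : ∀ {C F} → IsVertexCover C → IsEdgeCover F → IsTDS G (map inj₁ C ++ map inj₂ F)
  covers⇒TDS {C} vertexCover edgeCover (inj₁ v)
    with e , e∈F , v~e ← edgeCover v = inj₂ e , ∈-++⁺ʳ (map inj₁ C) (∈-map⁺ inj₂ e∈F) , v~e
  covers⇒TDS vertexCover edgeCover (inj₂ e) with vertexCover e
  ... | inj₁ x∈C = inj₁ _ , ∈-++⁺ˡ (∈-map⁺ inj₁ x∈C) , inj₁ refl
  ... | inj₂ y∈C = inj₁ _ , ∈-++⁺ˡ (∈-map⁺ inj₁ y∈C) , inj₂ refl

  endpoints : List E → List V
  endpoints []       = []
  endpoints (e ∷ es) = proj₁ (ends e) ∷ proj₂ (ends e) ∷ endpoints es

  length-endpoints : ∀ es → length (endpoints es) ≡ length es + length es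
  length-endpoints []       = refl
  length-endpoints (e ∷ es) = cong suc (trans (cong suc (length-endpoints es)) (sym (+-suc _ _)))

  ∈-endpoints⁺ : ∀ {v e es} → e ∈ es → Incident v e → v ∈ endpoints es
  ∈-endpoints⁺ (here refl)  (inj₁ refl) = here refl
  ∈-endpoints⁺ (here refl)  (inj₂ refl) = there (here refl)
  ∈-endpoints⁺ (there e∈es) v~e         = there (there (∈-endpoints⁺ e∈es v~e))

  edgeCover⇒∈endpoints : ∀ {F} → IsEdgeCover F → ∀ v → v ∈ endpoints F
  edgeCover⇒∈endpoints edgeCover v with e , e∈F , v~e ← edgeCover v = ∈-endpoints⁺ e∈F v~e

module _ {n : ℕ} where

  open Subdivided {Fin n} {KEdge n} proj₁ public

  edgeBetween : ∀ {v w : Fin n} → v ≢ w → Σ (KEdge n) λ e → proj₁ e ≡ (v , w) ⊎ proj₁ e ≡ (w , v)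
  edgeBetween {v} {w} v≢w with Fin.<-cmp v w
  ... | tri< v<w _ _ = ((v , w) , v<w) , inj₁ refl
  ... | tri≈ _ v≡w _ = contradiction v≡w v≢w
  ... | tri> _ _ w<v = ((w , v) , w<v) , inj₂ refl

  edgeJoining : ∀ {v w : Fin n} → v ≢ w → Σ (KEdge n) λ e → Incident v e × Incident w e
  edgeJoining v≢w with edgeBetween v≢w
  ... | e , inj₁ refl = e , inj₁ refl , inj₂ refl
  ... | e , inj₂ refl = e , inj₂ refl , inj₁ refl

  vertexCover⇒pairwise : ∀ {C} → IsVertexCover C → ∀ {v w} → v ≢ w → v ∈ C ⊎ w ∈ C
  vertexCover⇒pairwise cover v≢w with edgeBetween v≢w
  ... | e , inj₁ refl = cover e
  ... | e , inj₂ refl = swap (cover e)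

  edgeCover-length : ∀ {F} → IsEdgeCover F → ⌈ n /2⌉ ≤ length F
  edgeCover-length {F} cover = m≤n+n⇒⌈m/2⌉≤n (subst (n ≤_) (length-endpoints F)
    (injection⇒≤length id id (edgeCover⇒∈endpoints cover)))

module _ {m : ℕ} where

  open DecMembership (Fin._≟_ {suc m}) using (_∈?_)

  vertexCover-length : ∀ {C} → IsVertexCover C → m ≤ length C
  vertexCover-length {C} cover with Fin.all? (_∈? C)
  ... | yes all∈C = ≤-trans (n≤1+n m) (injection⇒≤length id id all∈C)
  ... | no ¬all∈C with w , w∉C ← Fin.¬∀⟶∃¬ _ _ (_∈? C) ¬all∈C =
    injection⇒≤length (punchIn w) (Fin.punchIn-injective w _ _) punchIn∈C
    where
    punchIn∈C : ∀ i → punchIn w i ∈ C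
    punchIn∈C i with vertexCover⇒pairwise cover (Fin.punchInᵢ≢i w i)
    ... | inj₁ p∈C = p∈C
    ... | inj₂ w∈C = contradiction w∈C w∉C

TDS-length : ∀ {m S} → IsTDS (SK (suc m)) S → m + ⌈ suc m /2⌉ ≤ length S
TDS-length {S = S} tds = subst (_ ≤_) (length-lefts+rights S)
  (+-mono-≤ (vertexCover-length (TDS⇒vertexCover tds)) (edgeCover-length (TDS⇒edgeCover tds)))

allFinExcept : ∀ {m} → Fin (suc m) → List (Fin (suc m))
allFinExcept {m} w = map (punchIn w) (allFin m)

length-allFinExcept : ∀ {m} (w : Fin (suc m)) → length (allFinExcept w) ≡ m
length-allFinExcept {m} w = trans (length-map (punchIn w) (allFin m)) (length-tabulate id)

∈-allFinExcept : ∀ {m} {w v : Fin (suc m)} → w ≢ v → v ∈ allFinExcept w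
∈-allFinExcept w≢v = subst (_∈ _) (Fin.punchIn-punchOut w≢v) (∈-map⁺ (punchIn _) (∈-allFin _))

allFinExcept₂ : ∀ {m} {i j : Fin (suc (suc m))} → i ≢ j → List (Fin (suc (suc m)))
allFinExcept₂ {i = i} i≢j = map (punchIn i) (allFinExcept (punchOut i≢j))

length-allFinExcept₂ : ∀ {m} {i j : Fin (suc (suc m))} (i≢j : i ≢ j) → length (allFinExcept₂ i≢j) ≡ m
length-allFinExcept₂ {i = i} i≢j =
  trans (length-map (punchIn i) (allFinExcept (punchOut i≢j))) (length-allFinExcept (punchOut i≢j))

∈-allFinExcept₂ : ∀ {m} {i j v : Fin (suc (suc m))} (i≢j : i ≢ j) → i ≢ v → j ≢ v →
                  v ∈ allFinExcept₂ i≢j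
∈-allFinExcept₂ i≢j i≢v j≢v = subst (_∈ _) (Fin.punchIn-punchOut i≢v)
  (∈-map⁺ (punchIn _) (∈-allFinExcept (j≢v ∘ Fin.punchOut-injective i≢j i≢v)))

allFinExcept-vertexCover : ∀ {m} (w : Fin (suc m)) → IsVertexCover (allFinExcept w)
allFinExcept-vertexCover w ((x , y) , x<y) with w Fin.≟ x
... | no w≢x   = inj₁ (∈-allFinExcept w≢x)
... | yes refl = inj₂ (∈-allFinExcept (Fin.<⇒≢ x<y))

module _ {k : ℕ} where

  join : (v w : Fin (suc (suc k))) → Σ (KEdge _) λ e → Incident v e × Incident w e
  join v w with v Fin.≟ w
  ... | no v≢w   = edgeJoining v≢w
  ... | yes refl with e , v~e , _ ← edgeJoining (Fin.punchInᵢ≢i v zero ∘ sym) = e , v~e , v~e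

  pairUp : List (Fin (suc (suc k))) → List (KEdge (suc (suc k)))
  pairUp []           = []
  pairUp (v ∷ [])     = proj₁ (join v v) ∷ []
  pairUp (v ∷ w ∷ vs) = proj₁ (join v w) ∷ pairUp vs

  length-pairUp : ∀ vs → length (pairUp vs) ≡ ⌈ length vs /2⌉
  length-pairUp []           = refl
  length-pairUp (_ ∷ [])     = refl
  length-pairUp (_ ∷ _ ∷ vs) = cong suc (length-pairUp vs)

  pairUp-covers : ∀ {u vs} → u ∈ vs → ∃ λ e → e ∈ pairUp vs × Incident u e
  pairUp-covers {vs = v ∷ []}     (here refl)         = _ , here refl , proj₁ (proj₂ (join v v))
  pairUp-covers {vs = v ∷ w ∷ _}  (here refl)         = _ , here refl , proj₁ (proj₂ (join v w))
  pairUp-covers {vs = v ∷ w ∷ _}  (there (here refl)) = _ , here refl , proj₂ (proj₂ (join v w))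
  pairUp-covers {vs = _ ∷ _ ∷ _}  (there (there u∈vs))
    with e , e∈ , u~e ← pairUp-covers u∈vs = e , there e∈ , u~e

  edgeCoverThrough : KEdge (suc (suc k)) → List (KEdge (suc (suc k)))
  edgeCoverThrough e@(_ , i<j) = e ∷ pairUp (allFinExcept₂ (Fin.<⇒≢ i<j))

  length-edgeCoverThrough : ∀ e → length (edgeCoverThrough e) ≡ ⌈ suc (suc k) /2⌉
  length-edgeCoverThrough (_ , i<j) = cong suc (trans (length-pairUp (allFinExcept₂ (Fin.<⇒≢ i<j)))
    (cong ⌈_/2⌉ (length-allFinExcept₂ (Fin.<⇒≢ i<j))))

  edgeCoverThrough-edgeCover : ∀ e → IsEdgeCover (edgeCoverThrough e)
  edgeCoverThrough-edgeCover e@((i , j) , i<j) v with i Fin.≟ v | j Fin.≟ v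
  ... | yes refl | _        = e , here refl , inj₁ refl
  ... | no _     | yes refl = e , here refl , inj₂ refl
  ... | no i≢v   | no j≢v
    with e′ , e′∈ , v~e′ ← pairUp-covers (∈-allFinExcept₂ (Fin.<⇒≢ i<j) i≢v j≢v) = e′ , there e′∈ , v~e′

  coverTDS : Fin (suc (suc k)) → KEdge (suc (suc k)) → List (Fin (suc (suc k)) ⊎ KEdge (suc (suc k)))
  coverTDS w e = map inj₁ (allFinExcept w) ++ map inj₂ (edgeCoverThrough e)

  coverTDS-TDS : ∀ w e → IsTDS (SK (suc (suc k))) (coverTDS w e)
  coverTDS-TDS w e = covers⇒TDS (allFinExcept-vertexCover w) (edgeCoverThrough-edgeCover e)

  length-coverTDS : ∀ w e → length (coverTDS w e) ≡ suc k + ⌈ suc (suc k) /2⌉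
  length-coverTDS w e = begin
    length (map inj₁ C ++ map inj₂ F)         ≡⟨ length-++ (map inj₁ C) ⟩
    length (map inj₁ C) + length (map inj₂ F) ≡⟨ cong₂ _+_ (length-map inj₁ C) (length-map inj₂ F) ⟩
    length C + length F                       ≡⟨ cong₂ _+_ (length-allFinExcept w) (length-edgeCoverThrough e) ⟩
    suc k + ⌈ suc (suc k) /2⌉                 ∎
    where
    open ≡-Reasoning
    C = allFinExcept w
    F = edgeCoverThrough e

  TDS-through : ∀ a → ∃ λ S → IsTDS (SK (suc (suc k))) S × a ∈ S × length S ≤ suc k + ⌈ suc (suc k) /2⌉
  TDS-through (inj₁ v) =
    coverTDS w e , coverTDS-TDS w e ,
    ∈-++⁺ˡ (∈-map⁺ inj₁ (∈-allFinExcept (Fin.punchInᵢ≢i v zero))) , ≤-reflexive (length-coverTDS w e)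
    where
    w = punchIn v zero
    e : KEdge (suc (suc k))
    e = (zero , suc zero) , s≤s z≤n
  TDS-through (inj₂ e) =
    coverTDS zero e , coverTDS-TDS zero e ,
    ∈-++⁺ʳ (map inj₁ (allFinExcept zero)) (∈-map⁺ inj₂ (here refl)) , ≤-reflexive (length-coverTDS zero e)

_≟ᵥ_ : ∀ {n} → DecidableEquality (V (SK n))
_≟ᵥ_ = Sum.≡-dec Fin._≟_ (Product.≡-dec (Product.≡-dec Fin._≟_ Fin._≟_) λ p q → yes (Fin.<-irrelevant p q))

theorem13 : (n : ℕ) → 2 ≤ n →
    CompliantGraph (SK n) × (∀ a → DtdIs (SK n) a (⌈ 3 * n /2⌉ ∸ 1))
theorem13 n@(suc (suc _)) (s≤s (s≤s z≤n)) = DtdIs⇒Compliant (SK n) ∘ dtd , dtd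
  where
  dtd : ∀ a → DtdIs (SK n) a (⌈ 3 * n /2⌉ ∸ 1)
  dtd a = subst (DtdIs (SK n) a) (sym (cong (_∸ 1) (⌈3n/2⌉≡n+⌈n/2⌉ n)))
    (minimum⇒DtdIs (SK n) _≟ᵥ_ (λ _ → TDS-length) (TDS-through a))
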